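{- Let $C$ be an $X$-neighbour transitive code in $H(m,q)$ with minimum distance $\delta\geq 3$, and let $\Delta$ be a block of imprimitivity for the action of $X$ on $C$. Then $\Delta$ is an $X_\Delta$-neighbour transitive code with minimum distance at least $\delta$, where $X_\Delta$ is the setwise stabiliser of $\Delta$ in $X$.
   Context: $H(m,q)$ is the Hamming graph on $Q^m$ ($|Q|=q$), vertices adjacent iff they differ in exactly one entry; $\mathrm{Aut}(H(m,q))=S_q^m\rtimes S_m$. For a code $C$ (a set of vertices), its neighbour set $C_1$ consists of the vertices at distance exactly $1$ from $C$. For $X\leq\mathrm{Aut}(H(m,q))$, $C$ is $X$-neighbour transitive if $C$ and $C_1$ are both $X$-orbits. The minimum distance of a code is the least Hamming distance between distinct codewords. -}

module Defs where

open import Data.Nat using (ℕ; zero; suc; _+_; _≤_)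
open import Data.Fin using (Fin; _≟_)
open import Data.Fin.Permutation using (Permutation′; _⟨$⟩ʳ_; _⟨$⟩ˡ_)
open import Data.Vec using (Vec; []; _∷_; lookup; tabulate)
open import Data.Product using (Σ; ∃; _×_; _,_)
open import Data.Sum using (_⊎_)
open import Relation.Binary.PropositionalEquality using (_≡_)
open import Relation.Nullary using (¬_; yes; no)

Vertex : ℕ → ℕ → Set
Vertex m q = Vec (Fin q) m

dist : ∀ {m q} → Vertex m q → Vertex m q → ℕ
dist [] [] = 0
dist (a ∷ α) (b ∷ β) with a ≟ b
... | yes _ = dist α β
... | no  _ = suc (dist α β)

Code : ℕ → ℕ → Set₁
Code m q = Vertex m q → Set

-- Elements of Aut(H(m,q)) = S_q^m ⋊ S_m: a family (h_1,…,h_m) of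
-- permutations of Q together with a permutation σ of the coordinates.
record Aut (m q : ℕ) : Set where
  field
    σ : Permutation′ m
    h : Fin m → Permutation′ q

-- Action: entry i of α is moved by h_i and placed at position iσ.
act : ∀ {m q} → Aut m q → Vertex m q → Vertex m q
act g α = tabulate λ j → h (σ ⟨$⟩ˡ j) ⟨$⟩ʳ lookup α (σ ⟨$⟩ˡ j)
  where open Aut g

-- X ≤ Aut(H(m,q)), given as a predicate on Aut m q which (via the
-- faithful action) contains the identity and is closed under products
-- and inverses.
record IsSubgroup {m q} (X : Aut m q → Set) : Set where
  field
    hasId  : Σ (Aut m q) λ e → X e × (∀ α → act e α ≡ α)
    hasMul : ∀ x y → X x → X y →
             Σ (Aut m q) λ z → X z × (∀ α → act z α ≡ act y (act x α))
    hasInv : ∀ x → X x →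
             Σ (Aut m q) λ z → X z × (∀ α → act z (act x α) ≡ α)

Nbr : ∀ {m q} → Code m q → Code m q
Nbr C ν = (¬ C ν) × (∃ λ α → C α × dist ν α ≡ 1)

IsOrbit : ∀ {m q} → (Aut m q → Set) → Code m q → Set
IsOrbit X S =
  (∃ λ α → S α) ×
  (∀ α → S α → ∀ β → (S β → Σ _ λ x → X x × β ≡ act x α)
                   × ((Σ _ λ x → X x × β ≡ act x α) → S β))

NeighbourTransitive : ∀ {m q} → (Aut m q → Set) → Code m q → Set
NeighbourTransitive X C = IsOrbit X C × IsOrbit X (Nbr C)

DistAtLeast : ∀ {m q} → Code m q → ℕ → Set
DistAtLeast C d = ∀ α β → C α → C β → ¬ (α ≡ β) → d ≤ dist α β

MinDist : ∀ {m q} → Code m q → ℕ → Set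
MinDist C δ = DistAtLeast C δ ×
  (∃ λ α → ∃ λ β → C α × C β × ¬ (α ≡ β) × dist α β ≡ δ)

Image : ∀ {m q} → Aut m q → Code m q → Code m q
Image x Δ β = ∃ λ α → Δ α × β ≡ act x α

SameSet : ∀ {m q} → Code m q → Code m q → Set
SameSet A B = ∀ β → (A β → B β) × (B β → A β)

Disjoint : ∀ {m q} → Code m q → Code m q → Set
Disjoint A B = ∀ β → ¬ (A β × B β)

IsBlock : ∀ {m q} → (Aut m q → Set) → Code m q → Code m q → Set
IsBlock X C Δ =
  (∀ α → Δ α → C α) × (∃ λ α → Δ α) ×
  (∀ x → X x → SameSet (Image x Δ) Δ ⊎ Disjoint (Image x Δ) Δ)

Stab : ∀ {m q} → (Aut m q → Set) → Code m q → Aut m q → Set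
Stab X Δ x = X x × SameSet (Image x Δ) Δ

-- Every x ∈ X is an isometry of H(m,q), and minimum distance at least 3
-- means a neighbour of C is adjacent to exactly one codeword. Hence if
-- x ∈ X maps a neighbour of Δ to another neighbour of Δ, it maps the
-- codeword of Δ adjacent to the first onto the one adjacent to the second,
-- so Δ^x meets Δ and, Δ being a block, x ∈ X_Δ. Transitivity of X_Δ on Δ
-- is the same argument with codewords in place of neighbours.
module Submission where

open import Defs
open import Data.Nat using (ℕ; suc; _+_; _≤_; z≤n; s≤s)
open import Data.Nat.Properties
  using (≤-refl; ≤-trans; 1+n≰n; +-mono-≤; +-commutativeSemigroup; +-0-commutativeMonoid)
open import Data.Fin using (Fin; _≟_)
open import Data.Fin.Permutation as Perm using (Permutation′; _⟨$⟩ʳ_; _⟨$⟩ˡ_)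
open import Data.Vec using ([]; _∷_; lookup)
open import Data.Vec.Properties using (lookup∘tabulate; ≡-dec)
open import Data.Product using (_×_; _,_; Σ; ∃; proj₁; proj₂)
open import Data.Sum using (inj₁; inj₂)
open import Data.Empty using (⊥-elim)
open import Relation.Binary.PropositionalEquality
open import Relation.Nullary using (¬_; yes; no)
open import Algebra.Properties.CommutativeSemigroup +-commutativeSemigroup using (interchange)
open import Algebra.Properties.CommutativeMonoid.Sum +-0-commutativeMonoid
  using (sum; sum-permute; sum-cong-≗)

dist₁ : ∀ {q} → Fin q → Fin q → ℕ
dist₁ a b with a ≟ b
... | yes _ = 0
... | no  _ = 1

dist-∷ : ∀ {m q} (a b : Fin q) (α β : Vertex m q) →
         dist (a ∷ α) (b ∷ β) ≡ dist₁ a b + dist α β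
dist-∷ a b α β with a ≟ b
... | yes _ = refl
... | no  _ = refl

dist≡sum : ∀ {m q} (α β : Vertex m q) →
           dist α β ≡ sum (λ i → dist₁ (lookup α i) (lookup β i))
dist≡sum []      []      = refl
dist≡sum (a ∷ α) (b ∷ β) = trans (dist-∷ a b α β) (cong (dist₁ a b +_) (dist≡sum α β))

dist-refl : ∀ {m q} (α : Vertex m q) → dist α α ≡ 0
dist-refl []      = refl
dist-refl (a ∷ α) with a ≟ a
... | yes _ = dist-refl α
... | no  a≢a = ⊥-elim (a≢a refl)

dist₁-sym : ∀ {q} (a b : Fin q) → dist₁ a b ≡ dist₁ b a
dist₁-sym a b with a ≟ b | b ≟ a
... | yes _    | yes _   = refl
... | no  _    | no  _   = refl
... | yes refl | no b≢a  = ⊥-elim (b≢a refl)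
... | no  a≢b  | yes refl = ⊥-elim (a≢b refl)

dist-sym : ∀ {m q} (α β : Vertex m q) → dist α β ≡ dist β α
dist-sym []      []      = refl
dist-sym (a ∷ α) (b ∷ β) rewrite dist-∷ a b α β | dist-∷ b a β α =
  cong₂ _+_ (dist₁-sym a b) (dist-sym α β)

dist₁-triangle : ∀ {q} (a b c : Fin q) → dist₁ a c ≤ dist₁ a b + dist₁ b c
dist₁-triangle a b c with a ≟ c | a ≟ b | b ≟ c
... | yes _   | _        | _        = z≤n
... | no  a≢c | yes refl | yes refl = ⊥-elim (a≢c refl)
... | no  _   | yes _    | no  _    = ≤-refl
... | no  _   | no  _    | _        = s≤s z≤n

dist-triangle : ∀ {m q} (α β γ : Vertex m q) → dist α γ ≤ dist α β + dist β γ
dist-triangle []      []      []      = z≤n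
dist-triangle (a ∷ α) (b ∷ β) (c ∷ γ)
  rewrite dist-∷ a c α γ | dist-∷ a b α β | dist-∷ b c β γ
        | interchange (dist₁ a b) (dist α β) (dist₁ b c) (dist β γ)
  = +-mono-≤ (dist₁-triangle a b c) (dist-triangle α β γ)

⟨$⟩ʳ-injective : ∀ {q} (π : Permutation′ q) {a b} → π ⟨$⟩ʳ a ≡ π ⟨$⟩ʳ b → a ≡ b
⟨$⟩ʳ-injective π {a} {b} πa≡πb = begin
  a                     ≡⟨ sym (Perm.inverseˡ π) ⟩
  π ⟨$⟩ˡ (π ⟨$⟩ʳ a)     ≡⟨ cong (π ⟨$⟩ˡ_) πa≡πb ⟩
  π ⟨$⟩ˡ (π ⟨$⟩ʳ b)     ≡⟨ Perm.inverseˡ π ⟩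
  b                     ∎
  where open ≡-Reasoning

dist₁-permute : ∀ {q} (π : Permutation′ q) a b → dist₁ (π ⟨$⟩ʳ a) (π ⟨$⟩ʳ b) ≡ dist₁ a b
dist₁-permute π a b with (π ⟨$⟩ʳ a) ≟ (π ⟨$⟩ʳ b) | a ≟ b
... | yes _  | yes _    = refl
... | no  _  | no  _    = refl
... | yes πa≡πb | no a≢b = ⊥-elim (a≢b (⟨$⟩ʳ-injective π πa≡πb))
... | no  πa≢πb | yes refl = ⊥-elim (πa≢πb refl)

-- Coordinate j of act g α is h_{jσ⁻¹} applied to coordinate jσ⁻¹ of α, so
-- the coordinatewise distances are those of α, β permuted by σ.
act-isometry : ∀ {m q} (g : Aut m q) (α β : Vertex m q) →
               dist (act g α) (act g β) ≡ dist α β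
act-isometry g α β = begin
  dist (act g α) (act g β)                  ≡⟨ dist≡sum (act g α) (act g β) ⟩
  sum (λ j → dist₁ (lookup (act g α) j) (lookup (act g β) j))
                                            ≡⟨ sum-cong-≗ coordinate ⟩
  sum (λ j → d (σ ⟨$⟩ˡ j))                  ≡⟨ sym (sum-permute d (Perm.flip σ)) ⟩
  sum d                                     ≡⟨ sym (dist≡sum α β) ⟩
  dist α β                                  ∎
  where
  open Aut g
  open ≡-Reasoning
  d = λ i → dist₁ (lookup α i) (lookup β i)
  coordinate : ∀ j → dist₁ (lookup (act g α) j) (lookup (act g β) j) ≡ d (σ ⟨$⟩ˡ j)
  coordinate j
    rewrite lookup∘tabulate (λ j → h (σ ⟨$⟩ˡ j) ⟨$⟩ʳ lookup α (σ ⟨$⟩ˡ j)) j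
          | lookup∘tabulate (λ j → h (σ ⟨$⟩ˡ j) ⟨$⟩ʳ lookup β (σ ⟨$⟩ˡ j)) j
    = dist₁-permute (h (σ ⟨$⟩ˡ j)) _ _

act-preserves-adjacency : ∀ {m q} (g : Aut m q) ν α →
                          dist ν α ≡ 1 → dist (act g ν) (act g α) ≡ 1
act-preserves-adjacency g ν α να≡1 = trans (act-isometry g ν α) να≡1

DistAtLeast-mono : ∀ {m q} {C : Code m q} {d e} → d ≤ e → DistAtLeast C e → DistAtLeast C d
DistAtLeast-mono d≤e C≥e α β α∈C β∈C α≢β = ≤-trans d≤e (C≥e α β α∈C β∈C α≢β)

DistAtLeast-⊆ : ∀ {m q} {Δ C : Code m q} {d} → (∀ α → Δ α → C α) →
                DistAtLeast C d → DistAtLeast Δ d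
DistAtLeast-⊆ Δ⊆C C≥d α β α∈Δ β∈Δ = C≥d α β (Δ⊆C α α∈Δ) (Δ⊆C β β∈Δ)

≡-if-dist≤ : ∀ {m q} {C : Code m q} {n} → DistAtLeast C (suc n) →
             ∀ {α β} → C α → C β → dist α β ≤ n → α ≡ β
≡-if-dist≤ {n = n} C≥1+n {α} {β} α∈C β∈C αβ≤n with ≡-dec _≟_ α β
... | yes α≡β = α≡β
... | no  α≢β = ⊥-elim (1+n≰n (≤-trans (C≥1+n α β α∈C β∈C α≢β) αβ≤n))

Nbr-intro : ∀ {m q} {C : Code m q} → DistAtLeast C 2 →
            ∀ ν {α} → C α → dist ν α ≡ 1 → Nbr C ν
Nbr-intro {C = C} C≥2 ν {α} α∈C να≡1 = ν∉C , α , α∈C , να≡1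
  where
  ν∉C : ¬ C ν
  ν∉C ν∈C with ≡-if-dist≤ C≥2 ν∈C α∈C (subst (_≤ 1) (sym να≡1) ≤-refl)
  ... | refl with trans (sym (dist-refl ν)) να≡1
  ... | ()

Nbr-⊆ : ∀ {m q} {Δ C : Code m q} → (∀ α → Δ α → C α) → DistAtLeast C 2 →
        ∀ ν → Nbr Δ ν → Nbr C ν
Nbr-⊆ Δ⊆C C≥2 ν (_ , α , α∈Δ , να≡1) = Nbr-intro C≥2 ν (Δ⊆C α α∈Δ) να≡1

adjacent-codeword-unique : ∀ {m q} {C : Code m q} → DistAtLeast C 3 →
  ∀ ν {α α′} → C α → C α′ → dist ν α ≡ 1 → dist ν α′ ≡ 1 → α ≡ α′
adjacent-codeword-unique C≥3 ν {α} {α′} α∈C α′∈C να≡1 να′≡1 =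
  ≡-if-dist≤ C≥3 α∈C α′∈C (≤-trans (dist-triangle α ν α′) αν+να′≤2)
  where
  αν+να′≤2 : dist α ν + dist ν α′ ≤ 2
  αν+να′≤2 rewrite dist-sym α ν | να≡1 | να′≡1 = ≤-refl

orbit-closed : ∀ {m q} {X : Aut m q → Set} {S : Code m q} → IsOrbit X S →
               ∀ {x α} → X x → S α → S (act x α)
orbit-closed (_ , orbit) {x} {α} x∈X α∈S = proj₂ (orbit α α∈S (act x α)) (x , x∈X , refl)

orbit-connects : ∀ {m q} {X : Aut m q → Set} {S : Code m q} → IsOrbit X S →
                 ∀ {α β} → S α → S β → Σ _ λ x → X x × β ≡ act x α
orbit-connects (_ , orbit) {α} {β} α∈S β∈S = proj₁ (orbit α α∈S β) β∈S

Stab-intro : ∀ {m q} {X : Aut m q → Set} {C Δ : Code m q} → IsBlock X C Δ →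
             ∀ {x α} → X x → Δ α → Δ (act x α) → Stab X Δ x
Stab-intro (_ , _ , block) {x} {α} x∈X α∈Δ xα∈Δ with block x x∈X
... | inj₁ Δˣ≡Δ    = x∈X , Δˣ≡Δ
... | inj₂ Δˣ∩Δ≡∅ = ⊥-elim (Δˣ∩Δ≡∅ (act x α) ((α , α∈Δ , refl) , xα∈Δ))

Stab-act : ∀ {m q} {X : Aut m q → Set} {Δ : Code m q} →
           ∀ {x α} → Stab X Δ x → Δ α → Δ (act x α)
Stab-act {α = α} (_ , Δˣ≡Δ) α∈Δ = proj₁ (Δˣ≡Δ _) (α , α∈Δ , refl)

block-isOrbit : ∀ {m q} {X : Aut m q → Set} {C Δ : Code m q} →
                IsOrbit X C → IsBlock X C Δ → IsOrbit (Stab X Δ) Δ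
block-isOrbit {X = X} {Δ = Δ} orbC blk@(Δ⊆C , Δ≢∅ , _) =
  Δ≢∅ , λ α α∈Δ β → to α α∈Δ β , from α α∈Δ β
  where
  to : ∀ α → Δ α → ∀ β → Δ β → Σ _ λ x → Stab X Δ x × β ≡ act x α
  to α α∈Δ β β∈Δ with orbit-connects orbC (Δ⊆C α α∈Δ) (Δ⊆C β β∈Δ)
  ... | x , x∈X , refl = x , Stab-intro blk x∈X α∈Δ β∈Δ , refl
  from : ∀ α → Δ α → ∀ β → (Σ _ λ x → Stab X Δ x × β ≡ act x α) → Δ β
  from α α∈Δ _ (x , x∈X_Δ , refl) = Stab-act {X = X} x∈X_Δ α∈Δ

block-Nbr-isOrbit : ∀ {m q} {X : Aut m q → Set} {C Δ : Code m q} → DistAtLeast C 3 →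
  IsOrbit X C → IsOrbit X (Nbr C) → IsBlock X C Δ → IsOrbit (Stab X Δ) (Nbr Δ)
block-Nbr-isOrbit {X = X} {C} {Δ} C≥3 orbC orbN blk@(Δ⊆C , (α₀ , α₀∈Δ) , _) =
  nonempty , λ ν ν∈NΔ β → to ν ν∈NΔ β , from ν ν∈NΔ β
  where
  C≥2 : DistAtLeast C 2
  C≥2 = DistAtLeast-mono (s≤s (s≤s z≤n)) C≥3
  Δ≥2 : DistAtLeast Δ 2
  Δ≥2 = DistAtLeast-⊆ Δ⊆C C≥2

  nonempty : ∃ λ ν → Nbr Δ ν
  nonempty with proj₁ orbN
  ... | ν , _ , γ , γ∈C , νγ≡1 with orbit-connects orbC γ∈C (Δ⊆C α₀ α₀∈Δ)
  ... | x , _ , refl = act x ν , Nbr-intro Δ≥2 (act x ν) α₀∈Δ (act-preserves-adjacency x ν γ νγ≡1)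

  to : ∀ ν → Nbr Δ ν → ∀ β → Nbr Δ β → Σ _ λ x → Stab X Δ x × β ≡ act x ν
  to ν ν∈NΔ@(_ , α , α∈Δ , να≡1) β β∈NΔ@(_ , α′ , α′∈Δ , βα′≡1)
    with orbit-connects orbN (Nbr-⊆ Δ⊆C C≥2 ν ν∈NΔ) (Nbr-⊆ Δ⊆C C≥2 β β∈NΔ)
  ... | x , x∈X , refl = x , Stab-intro blk x∈X α∈Δ xα∈Δ , refl
    where
    xα≡α′ : act x α ≡ α′
    xα≡α′ = adjacent-codeword-unique C≥3 (act x ν) (orbit-closed orbC x∈X (Δ⊆C α α∈Δ))
              (Δ⊆C α′ α′∈Δ) (act-preserves-adjacency x ν α να≡1) βα′≡1
    xα∈Δ : Δ (act x α)
    xα∈Δ = subst Δ (sym xα≡α′) α′∈Δ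

  from : ∀ ν → Nbr Δ ν → ∀ β → (Σ _ λ x → Stab X Δ x × β ≡ act x ν) → Nbr Δ β
  from ν (_ , α , α∈Δ , να≡1) _ (x , x∈X_Δ , refl) =
    Nbr-intro Δ≥2 (act x ν) (Stab-act {X = X} x∈X_Δ α∈Δ) (act-preserves-adjacency x ν α να≡1)

lemma2p7 : ∀ {m q : ℕ} (X : Aut m q → Set) (C Δ : Code m q) (δ : ℕ) →
    IsSubgroup X →
    NeighbourTransitive X C →
    MinDist C δ →
    3 ≤ δ →
    IsBlock X C Δ →
    NeighbourTransitive (Stab X Δ) Δ × DistAtLeast Δ δ
lemma2p7 X C Δ δ _ (orbC , orbN) (C≥δ , _) 3≤δ blk@(Δ⊆C , _) =
  (block-isOrbit orbC blk , block-Nbr-isOrbit (DistAtLeast-mono 3≤δ C≥δ) orbC orbN blk) ,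
  DistAtLeast-⊆ Δ⊆C C≥δ
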